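{- Let $\mathfrak{P} = (\mathsf{Loc}, \mathsf{Var}, \mathsf{dom}, \mathsf{Cmd}, \iota)$ be a PCFP and let $x \in \mathsf{Var}$ be unfoldable. Then the semantic MDPs of $\mathsf{Unf}(\mathfrak{P}, x)$ and of $\mathfrak{P}$ coincide, $\mathcal{M}_{\mathsf{Unf}(\mathfrak{P}, x)} = \mathcal{M}_{\mathfrak{P}}$, up to renaming of states (identifying the state $\langle\langle l, \nu(x)\rangle, \nu'\rangle$ of the former with the state $\langle l, \nu\rangle$ of the latter, where $\nu'$ is the restriction of $\nu$ to $\mathsf{Var}\setminus\{x\}$) and of action labels.
   Context: Let $\mathsf{Var}$ be a finite set of integer variables. A valuation is a map $\nu \in \mathbb{Z}^{\mathsf{Var}}$. An update $u = [x_1' = f_1(x_1,\dots,x_n), \dots, x_n' = f_n(x_1,\dots,x_n)]$ is a set of assignments executed simultaneously (the $f_i$ are integer-valued expressions); it maps a valuation $\nu$ to the valuation $u(\nu)$. A guard is a Boolean expression over the variables. A (location-guided) command has the form $l, \varphi \to p_1 : u_1 : l_1 + \dots + p_k : u_k : l_k$ where $l, l_1,\dots,l_k$ are locations, $\varphi$ is a guard, $u_i$ are updates and $p_i \ge 0$ are constant reals summing to $1$; each summand gives a transition $l \xrightarrow{\varphi \to p_i : u_i} l_i$. A PCFP is a tuple $\mathfrak{P} = (\mathsf{Loc}, \mathsf{Var}, \mathsf{dom}, \mathsf{Cmd}, \iota)$ with $\mathsf{Loc}$ a finite nonempty set of locations, $\mathsf{dom}$ assigning each $x\in\mathsf{Var}$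 a finite set $\mathsf{dom}(x)\subseteq \mathbb{Z}$, $\mathsf{Cmd}$ a set of commands, and $\iota = (l_\iota, \nu_\iota)$ the initial location/valuation; $\nu \in \mathsf{dom}$ means $\nu(x)\in\mathsf{dom}(x)$ for all $x$. Semantic MDP $\mathcal{M}_{\mathfrak{P}}$: states $\mathsf{Loc} \times \{\nu \in \mathsf{dom}\} \cup \{\bot\}$, initial state $\langle l_\iota, \nu_\iota\rangle$, one action $a_\gamma$ per command $\gamma$; for each transition $l_1 \xrightarrow{\varphi \to p : u} l_2$ of command $\gamma$ and each $\nu \in\mathsf{dom}$ with $\nu \models \varphi$, there is a transition $\langle l_1, \nu\rangle \xrightarrow{a_\gamma, p} \langle l_2, u(\nu)\rangle$ if $u(\nu) \in \mathsf{dom}$ and $\langle l_1, \nu\rangle \xrightarrow{a_\gamma, p} \bot$ otherwise. Unfoldability: write $x \rightarrow y$ if some assignment occurring in an update of $\mathfrak{P}$ has left-hand side $x$ and a right-hand side containing $y$. A variable $x$ is unfoldable if $x \rightarrow y$ implies $x = y$. Unfolding: for unfoldable $x$, $\mathsf{Unf}(\mathfrak{P}, x) = (\mathsf{Loc} \times \mathsf{dom}(x), \mathsf{Var}\setminus\{x\}, \mathsf{dom}, \mathsf{Cmd}', \langle l_\iota, \nu_\iota(x)\rangle)$ (with initial valuation the restriction of $\nu_\iota$), where for every transition $l \xrightarrow{\varphi \to p : u} l'$ of $\mathfrak{P}$ and every valuation $\nu : \{x\} \to \mathsf{dom}(x)$, $\mathsf{Cmd}'$ contains the transition $\langle l, \nu(x)\rangle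 \xrightarrow{\varphi[\nu] \to p : u[\nu]} \langle l', u(\nu)(x)\rangle$ (grouped into commands as in $\mathfrak{P}$). Here $\varphi[\nu]$, $u[\nu]$ denote substitution of the value $\nu(x)$ for $x$ (removing from $u$ assignments whose left-hand side becomes constant), while $u(\nu)(x)$ is the value of $x$ after applying $u$, which is well-defined because $x$ is unfoldable.
   Formalization: The locations of $\mathsf{Unf}(\mathfrak{P}, x)$ range over Loc × ℤ rather than Loc × dom(x), only those ⟨l, z⟩ with z ∈ dom(x) giving states, so a transition to ⟨l', u(ν)(x)⟩ with u(ν)(x) ∉ dom(x) goes to ⊥. The statement above fails without it. -}

module Defs where

open import Level using (Level; _⊔_) renaming (suc to lsuc; zero to lzero)
open import Algebra.Bundles using (CommutativeSemiring)
open import Data.Bool using (Bool; true; false; _∧_; _∨_; not; if_then_else_; T)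
open import Data.Nat using (ℕ; suc)
open import Data.Integer as ℤ using (ℤ; +_)
open import Data.Fin using (Fin; punchIn; punchOut)
import Data.Fin as Fin
open import Data.Vec using (Vec; lookup; removeAt; insertAt; tabulate; replicate)
import Data.Vec.Properties as VecP
open import Data.List using (List; []; _∷_; map; foldr; concatMap; length; allFin)
open import Data.Bool.ListAction using (any; all)
import Data.List as List
open import Data.List.Membership.Propositional using (_∈_)
open import Data.List.Relation.Unary.Unique.Propositional using (Unique)
open import Data.Maybe using (Maybe; just; nothing; maybe)
import Data.Maybe as Maybe
import Data.Maybe.Properties as MaybeP
open import Data.Product using (Σ; _×_; _,_; proj₁; proj₂; ∃)
import Data.Product.Properties as ProdP
open import Relation.Binary.PropositionalEquality using (_≡_; refl; sym)
open import Relation.Binary.Definitions using (DecidableEquality)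
open import Relation.Nullary using (does; yes; no)
open import Function.Bundles using (_↔_; Inverse)

data Expr (n : ℕ) : Set where
  lit : ℤ → Expr n
  var : Fin n → Expr n
  op₁ : (ℤ → ℤ) → Expr n → Expr n
  op₂ : (ℤ → ℤ → ℤ) → Expr n → Expr n → Expr n

data Guard (n : ℕ) : Set where
  tt   : Guard n
  rel  : (ℤ → ℤ → Bool) → Expr n → Expr n → Guard n
  neg  : Guard n → Guard n
  conj : Guard n → Guard n → Guard n
  disj : Guard n → Guard n → Guard n

module _ {n : ℕ} where

  eval : Expr n → Vec ℤ n → ℤ
  eval (lit k)      ν = k
  eval (var i)      ν = lookup ν i
  eval (op₁ f e)    ν = f (eval e ν)
  eval (op₂ f e e') ν = f (eval e ν) (eval e' ν)

  holds : Guard n → Vec ℤ n → Bool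
  holds tt            ν = true
  holds (rel r e e')  ν = r (eval e ν) (eval e' ν)
  holds (neg g)       ν = not (holds g ν)
  holds (conj g g')   ν = holds g ν ∧ holds g' ν
  holds (disj g g')   ν = holds g ν ∨ holds g' ν

  data Occurs (y : Fin n) : Expr n → Set where
    here  : Occurs y (var y)
    in₁   : ∀ {f e} → Occurs y e → Occurs y (op₁ f e)
    in₂ˡ  : ∀ {f e e'} → Occurs y e → Occurs y (op₂ f e e')
    in₂ʳ  : ∀ {f e e'} → Occurs y e' → Occurs y (op₂ f e e')

-- An update: for each variable, optionally an assignment x_i' = e_i
-- (unassigned variables keep their value); executed simultaneously.
Update : ℕ → Set
Update n = Vec (Maybe (Expr n)) n

applyU : ∀ {n} → Update n → Vec ℤ n → Vec ℤ n
applyU u ν = tabulate (λ i → maybe (λ e → eval e ν) (lookup ν i) (lookup u i))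

-- finite domains as duplicate-free lists; membership test
_∈ᵇ_ : ℤ → List ℤ → Bool
z ∈ᵇ d = any (λ w → does (z ℤ.≟ w)) d

inDom : ∀ {n} → (Fin n → List ℤ) → Vec ℤ n → Bool
inDom {n} dom ν = all (λ i → lookup ν i ∈ᵇ dom i) (allFin n)

module _ {c ℓ : Level} (R : CommutativeSemiring c ℓ) where
  open CommutativeSemiring R using (_≈_; _+_; 0#; 1#) renaming (Carrier to Prob)

  record Branch (Loc : Set) (n : ℕ) : Set c where
    constructor branch
    field
      prob : Prob
      upd  : Update n
      tgt  : Loc

  -- command  l, φ → p₁ : u₁ : l₁ + … + p_k : u_k : l_k
  record Command (Loc : Set) (n : ℕ) : Set c where
    constructor command
    field
      src      : Loc
      guard    : Guard n
      branches : List (Branch Loc n)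

  -- A PCFP with variables Fin n.  Locations: a type with decidable
  -- equality together with a Boolean membership test isLoc (the
  -- location set is {l | isLoc l}).
  record PCFP (n : ℕ) : Set (lsuc lzero ⊔ c) where
    field
      Loc    : Set
      _≟L_   : DecidableEquality Loc
      isLoc  : Loc → Bool
      dom    : Fin n → List ℤ
      cmds   : List (Command Loc n)
      ι-loc  : Loc
      ι-val  : Vec ℤ n

  sumP : List Prob → Prob
  sumP = foldr _+_ 0#

  module _ {n : ℕ} (P : PCFP n) where
    open PCFP P

    RawState : Set
    RawState = Maybe (Loc × Vec ℤ n)          -- nothing = ⊥

    okRaw : RawState → Bool
    okRaw nothing        = true
    okRaw (just (l , ν)) = isLoc l ∧ inDom dom ν

    initOK : Set
    initOK = T (okRaw (just (ι-loc , ι-val)))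

    WF : Set (c ⊔ ℓ)
    WF = (∀ i → Unique (dom i))
       × (∀ γ → γ ∈ cmds → sumP (map Branch.prob (Command.branches γ)) ≈ 1#)
       × initOK

    DependsOn : Fin n → Fin n → Set c
    DependsOn x y = Σ (Command Loc n) λ γ → γ ∈ cmds ×
                    Σ (Branch Loc n) λ b → b ∈ Command.branches γ ×
                    Σ (Expr n) λ e → lookup (Branch.upd b) x ≡ just e × Occurs y e

    Unfoldable : Fin n → Set c
    Unfoldable x = ∀ y → DependsOn x y → x ≡ y

    _≟R_ : DecidableEquality RawState
    _≟R_ = MaybeP.≡-dec (ProdP.≡-dec _≟L_ (VecP.≡-dec ℤ._≟_))

    cmdAt : Fin (length cmds) → Command Loc n
    cmdAt = List.lookup cmds

    enabled : RawState → Fin (length cmds) → Bool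
    enabled nothing        i = false
    enabled (just (l , ν)) i =
      does (l ≟L Command.src (cmdAt i)) ∧ holds (Command.guard (cmdAt i)) ν

    target : Vec ℤ n → Branch Loc n → RawState
    target ν b = if isLoc (Branch.tgt b) ∧ inDom dom (applyU (Branch.upd b) ν)
                 then just (Branch.tgt b , applyU (Branch.upd b) ν)
                 else nothing

    probRaw : RawState → Fin (length cmds) → RawState → Prob
    probRaw nothing        i t = 0#
    probRaw (just (l , ν)) i t =
      sumP (map (λ b → if does (target ν b ≟R t) then Branch.prob b else 0#)
                (Command.branches (cmdAt i)))

  record MDP : Set (lsuc lzero ⊔ c) where
    field
      State : Set
      init  : State
      Act   : State → Set
      Pr    : (s : State) → Act s → State → Prob

  ⟦_⟧ : ∀ {n} (P : PCFP n) → initOK P → MDP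
  ⟦ P ⟧ ok = record
    { State = Σ (RawState P) (λ s → T (okRaw P s))
    ; init  = just (PCFP.ι-loc P , PCFP.ι-val P) , ok
    ; Act   = λ s → Σ (Fin (length (PCFP.cmds P))) (λ i → T (enabled P (proj₁ s) i))
    ; Pr    = λ s a t → probRaw P (proj₁ s) (proj₁ a) (proj₁ t)
    }

  record MDPIso (M₁ M₂ : MDP) : Set (c ⊔ ℓ) where
    module M₁ = MDP M₁
    module M₂ = MDP M₂
    field
      st    : M₁.State ↔ M₂.State
      init  : Inverse.to st M₁.init ≡ M₂.init
      act   : ∀ s → M₁.Act s ↔ M₂.Act (Inverse.to st s)
      pr    : ∀ s a t → M₁.Pr s a t ≈ M₂.Pr (Inverse.to st s) (Inverse.to (act s) a) (Inverse.to st t)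

  module _ {n : ℕ} (x : Fin (suc n)) (z : ℤ) where

    substE : Expr (suc n) → Expr n
    substE (lit k) = lit k
    substE (var i) with i Fin.≟ x
    ... | yes _  = lit z
    ... | no i≢x = var (punchOut {i = x} {j = i} (λ eq → i≢x (sym eq)))
    substE (op₁ f e)    = op₁ f (substE e)
    substE (op₂ f e e') = op₂ f (substE e) (substE e')

    substG : Guard (suc n) → Guard n
    substG tt           = tt
    substG (rel r e e') = rel r (substE e) (substE e')
    substG (neg g)      = neg (substG g)
    substG (conj g g')  = conj (substG g) (substG g')
    substG (disj g g')  = disj (substG g) (substG g')

    substU : Update (suc n) → Update n
    substU u = tabulate (λ i → Maybe.map substE (lookup u (punchIn x i)))

    -- u(ν)(x): the value of x after u (depends only on x when x is
    -- unfoldable; the other variables are set to 0, which is irrelevant)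
    newX : Update (suc n) → ℤ
    newX u = maybe (λ e → eval (substE e) (replicate n (+ 0))) z (lookup u x)

  module _ {n : ℕ} (P : PCFP (suc n)) (x : Fin (suc n)) where
    open PCFP P

    unfBranch : ℤ → Branch Loc (suc n) → Branch (Loc × ℤ) n
    unfBranch z b = branch (Branch.prob b) (substU x z (Branch.upd b))
                           (Branch.tgt b , newX x z (Branch.upd b))

    unfCmd : Command Loc (suc n) → ℤ → Command (Loc × ℤ) n
    unfCmd γ z = command (Command.src γ , z) (substG x z (Command.guard γ))
                         (map (unfBranch z) (Command.branches γ))

    Unf : PCFP n
    Unf = record
      { Loc   = Loc × ℤ
      ; _≟L_  = ProdP.≡-dec _≟L_ ℤ._≟_
      ; isLoc = λ { (l , z) → isLoc l ∧ (z ∈ᵇ dom x) }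
      ; dom   = λ i → dom (punchIn x i)
      ; cmds  = concatMap (λ γ → map (unfCmd γ) (dom x)) cmds
      ; ι-loc = ι-loc , lookup ι-val x
      ; ι-val = removeAt ι-val x
      }

    rename : RawState Unf → RawState P
    rename nothing               = nothing
    rename (just ((l , z) , ν')) = just (l , insertAt ν' x z)

module Submission where

-- Substituting the current value z of x commutes with evaluation: an expression e[z/x] evaluated
-- at ν′ equals e evaluated at ν′ extended by x ↦ z.  Hence guards agree under the renaming
-- ⟨⟨l, z⟩, ν′⟩ ↦ ⟨l, ν′[x ↦ z]⟩, and since x is unfoldable the right-hand side of an assignment
-- to x becomes a constant, so the unfolded update followed by the renaming computes u(ν).
-- The commands of the unfolding are the copies γ[z′/x], one per pair (γ, z′) with z′ ∈ dom(x);
-- in a state whose location records z only the copy with z′ = z can be enabled, and dom(x) has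
-- no duplicates, so enabled actions correspond one-to-one and have the same distributions.

open import Defs

open import Level using (Level)
open import Algebra.Bundles using (CommutativeSemiring)
open import Data.Bool using (Bool; true; not; _∧_; _∨_; T; if_then_else_)
open import Data.Bool.Properties using (T-∧; T-≡; T-irrelevant; ⇔→≡; ∧-assoc; if-float)
open import Data.Empty using (⊥-elim)
open import Data.Fin using (Fin; zero; suc; punchIn; punchOut)
import Data.Fin as Fin
open import Data.Fin.Properties using (punchIn-punchOut)
open import Data.Integer as ℤ using (ℤ)
open import Data.List using (List; []; _∷_; map; _++_; concatMap; length)
import Data.List as List
open import Data.List.Membership.Propositional using (_∈_)
open import Data.List.Membership.Propositional.Properties using (∈-lookup)
open import Data.List.Properties using (map-∘; map-cong-local)
import Data.List.Relation.Unary.All as All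
open import Data.List.Relation.Unary.All.Properties using (all⁺; all⁻; tabulate⁺; tabulate⁻)
open import Data.List.Relation.Unary.AllPairs using (_∷_)
open import Data.List.Relation.Unary.Any as Any using (Any; index)
open import Data.List.Relation.Unary.Any.Properties using (any⁻; lookup-index)
open import Data.List.Relation.Unary.Unique.Propositional using (Unique)
open import Data.Maybe using (just; nothing; maybe′)
import Data.Maybe as Maybe
open import Data.Nat using (ℕ; suc)
open import Data.Product using (Σ; ∃; _×_; _,_; proj₁; proj₂; uncurry)
import Data.Product as Product
open import Data.Product.Properties using (,-injective)
open import Data.Sum using (_⊎_; inj₁; inj₂; [_,_]′)
import Data.Sum as Sum
open import Data.Vec using (Vec; lookup; tabulate; insertAt; removeAt; replicate)
open import Data.Vec.Properties
  using (lookup∘tabulate; tabulate∘lookup; tabulate-cong;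
         insertAt-lookup; insertAt-punchIn; insertAt-removeAt; removeAt-insertAt)
open import Function using (_∘_; const)
open import Function.Bundles using (Inverse; _↔_; _⇔_; mk↔ₛ′; mk⇔; Equivalence)
open import Function.Definitions using (Injective)
open import Relation.Binary.Definitions using (DecidableEquality)
open import Relation.Binary.PropositionalEquality
open import Relation.Nullary using (Dec; yes; no; does; Irrelevant)

private variable
  a b c : Level
  A B C : Set a
  n : ℕ

Σ-irrelevant-↔ : {P : A → Set} {Q : B → Set} →
  (∀ {x} → Irrelevant (P x)) → (∀ {y} → Irrelevant (Q y)) →
  (f : A → B) (g : B → A) →
  (∀ {x} → P x → Q (f x)) → (∀ {y} → Q y → P (g y)) →
  (∀ {y} → Q y → f (g y) ≡ y) → (∀ {x} → P x → g (f x) ≡ x) →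
  Σ A P ↔ Σ B Q
Σ-irrelevant-↔ P-irr Q-irr f g f-pres g-pres f∘g g∘f =
  mk↔ₛ′ (Product.map f f-pres) (Product.map g g-pres)
        (λ (y , q) → Σ-≡ Q-irr (f∘g q)) (λ (x , p) → Σ-≡ P-irr (g∘f p))
  where
  Σ-≡ : ∀ {R : C → Set} → (∀ {z} → Irrelevant (R z)) →
        ∀ {z z′} {r : R z} {r′ : R z′} → z ≡ z′ → (z , r) ≡ (z′ , r′)
  Σ-≡ R-irr refl = cong (_ ,_) (R-irr _ _)

T-does : (a? : Dec A) → T (does a?) ⇔ A
T-does (yes a) = mk⇔ (const a) (const _)
T-does (no ¬a) = mk⇔ (λ ()) ¬a

T-injective : {x y : Bool} → T x ⇔ T y → x ≡ y
T-injective Tx⇔Ty = ⇔→≡ {z = true} (mk⇔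
  (Equivalence.to T-≡ ∘ Equivalence.to Tx⇔Ty ∘ Equivalence.from T-≡)
  (Equivalence.to T-≡ ∘ Equivalence.from Tx⇔Ty ∘ Equivalence.from T-≡))

injective⇒does-≡ : (f : A → B) → Injective _≡_ _≡_ f →
  (_≟A_ : DecidableEquality A) (_≟B_ : DecidableEquality B) →
  ∀ a a′ → does (a ≟A a′) ≡ does (f a ≟B f a′)
injective⇒does-≡ f f-inj _≟A_ _≟B_ a a′ with a ≟A a′ | f a ≟B f a′
... | yes _    | yes _      = refl
... | yes a≡a′ | no fa≢fa′  = ⊥-elim (fa≢fa′ (cong f a≡a′))
... | no a≢a′  | yes fa≡fa′ = ⊥-elim (a≢a′ (f-inj fa≡fa′))
... | no _     | no _       = refl

lookup-injective : {xs : List A} → Unique xs →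
  (i j : Fin (length xs)) → List.lookup xs i ≡ List.lookup xs j → i ≡ j
lookup-injective (_  ∷ _)  zero    zero    _  = refl
lookup-injective (x∉ ∷ _)  zero    (suc j) eq = ⊥-elim (All.lookup x∉ (∈-lookup j) eq)
lookup-injective (x∉ ∷ _)  (suc i) zero    eq = ⊥-elim (All.lookup x∉ (∈-lookup i) (sym eq))
lookup-injective (_  ∷ xs) (suc i) (suc j) eq = cong suc (lookup-injective xs i j eq)

∈ᵇ⇒lookup : ∀ {z : ℤ} d → T (z ∈ᵇ d) → ∃ λ j → List.lookup d j ≡ z
∈ᵇ⇒lookup {z} d z∈d = index z∈ , sym (lookup-index z∈)
  where
  z∈ : Any (z ≡_) d
  z∈ = Any.map (Equivalence.to (T-does (z ℤ.≟ _))) (any⁻ _ d z∈d)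

module _ {B : Set b} {C : Set c} (g : B → C) (zs : List C) where

  inBlock : ∀ ys → Fin (length ys) → Fin (length (map g ys ++ zs))
  inBlock (_ ∷ _)  zero    = zero
  inBlock (_ ∷ ys) (suc j) = suc (inBlock ys j)

  afterBlock : ∀ ys → Fin (length zs) → Fin (length (map g ys ++ zs))
  afterBlock []       k = k
  afterBlock (_ ∷ ys) k = suc (afterBlock ys k)

  splitBlock : ∀ ys → Fin (length (map g ys ++ zs)) → Fin (length ys) ⊎ Fin (length zs)
  splitBlock []       k       = inj₂ k
  splitBlock (_ ∷ ys) zero    = inj₁ zero
  splitBlock (_ ∷ ys) (suc k) = Sum.map₁ suc (splitBlock ys k)

  splitBlock-inBlock : ∀ ys j → splitBlock ys (inBlock ys j) ≡ inj₁ j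
  splitBlock-inBlock (_ ∷ ys) zero    = refl
  splitBlock-inBlock (_ ∷ ys) (suc j) = cong (Sum.map₁ suc) (splitBlock-inBlock ys j)

  splitBlock-afterBlock : ∀ ys k → splitBlock ys (afterBlock ys k) ≡ inj₂ k
  splitBlock-afterBlock []       k = refl
  splitBlock-afterBlock (_ ∷ ys) k = cong (Sum.map₁ suc) (splitBlock-afterBlock ys k)

  join-splitBlock : ∀ ys k → [ inBlock ys , afterBlock ys ]′ (splitBlock ys k) ≡ k
  join-splitBlock []       k       = refl
  join-splitBlock (_ ∷ ys) zero    = refl
  join-splitBlock (_ ∷ ys) (suc k) with splitBlock ys k | join-splitBlock ys k
  ... | inj₁ _ | eq = cong suc eq
  ... | inj₂ _ | eq = cong suc eq

  lookup-inBlock : ∀ ys j → List.lookup (map g ys ++ zs) (inBlock ys j) ≡ g (List.lookup ys j)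
  lookup-inBlock (_ ∷ ys) zero    = refl
  lookup-inBlock (_ ∷ ys) (suc j) = lookup-inBlock ys j

  lookup-afterBlock : ∀ ys k → List.lookup (map g ys ++ zs) (afterBlock ys k) ≡ List.lookup zs k
  lookup-afterBlock []       k = refl
  lookup-afterBlock (_ ∷ ys) k = lookup-afterBlock ys k

module Grid {A : Set a} {B : Set b} {C : Set c} (f : A → B → C) (ys : List B) where

  grid : List A → List C
  grid = concatMap (λ x → map (f x) ys)

  pair : ∀ xs → Fin (length xs) → Fin (length ys) → Fin (length (grid xs))
  pair (x ∷ xs) zero    j = inBlock (f x) _ ys j
  pair (x ∷ xs) (suc i) j = afterBlock (f x) _ ys (pair xs i j)

  unpair : ∀ xs → Fin (length (grid xs)) → Fin (length xs) × Fin (length ys)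
  unpair (x ∷ xs) k = [ (zero ,_) , Product.map₁ suc ∘ unpair xs ]′ (splitBlock (f x) _ ys k)

  unpair-pair : ∀ xs i j → unpair xs (pair xs i j) ≡ (i , j)
  unpair-pair (x ∷ xs) zero    j rewrite splitBlock-inBlock (f x) (grid xs) ys j = refl
  unpair-pair (x ∷ xs) (suc i) j
    rewrite splitBlock-afterBlock (f x) (grid xs) ys (pair xs i j) | unpair-pair xs i j = refl

  pair-unpair : ∀ xs k → uncurry (pair xs) (unpair xs k) ≡ k
  pair-unpair (x ∷ xs) k with splitBlock (f x) _ ys k | join-splitBlock (f x) (grid xs) ys k
  ... | inj₁ j  | eq = eq
  ... | inj₂ k′ | eq = trans (cong (afterBlock (f x) _ ys) (pair-unpair xs k′)) eq

  lookup-pair : ∀ xs i j → List.lookup (grid xs) (pair xs i j) ≡ f (List.lookup xs i) (List.lookup ys j)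
  lookup-pair (x ∷ xs) zero    j = lookup-inBlock (f x) _ ys j
  lookup-pair (x ∷ xs) (suc i) j = trans (lookup-afterBlock (f x) _ ys (pair xs i j)) (lookup-pair xs i j)

lookup-insertAt-elim : ∀ (P : Fin (suc n) → A → Set) (ν : Vec A n) x z →
  P x z → (∀ j → P (punchIn x j) (lookup ν j)) → ∀ i → P i (lookup (insertAt ν x z) i)
lookup-insertAt-elim P ν x z Px Pν i with i Fin.≟ x
... | yes refl = subst (P x) (sym (insertAt-lookup ν x z)) Px
... | no i≢x   = subst (λ k → P k (lookup (insertAt ν x z) k)) (punchIn-punchOut (i≢x ∘ sym))
                       (subst (P _) (sym (insertAt-punchIn ν x z _)) (Pν _))

insertAt-unique : ∀ (ν : Vec A n) x z (w : Vec A (suc n)) →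
  lookup w x ≡ z → (∀ j → lookup w (punchIn x j) ≡ lookup ν j) → insertAt ν x z ≡ w
insertAt-unique ν x z w wx≡z w∘punchIn≡ν = begin
  insertAt ν x z                          ≡⟨ cong₂ (λ ν′ z′ → insertAt ν′ x z′) ν≡ (sym wx≡z) ⟩
  insertAt (removeAt w x) x (lookup w x)  ≡⟨ insertAt-removeAt w x ⟩
  w                                       ∎
  where
  open ≡-Reasoning
  lookup-removeAt : ∀ j → lookup (removeAt w x) j ≡ lookup w (punchIn x j)
  lookup-removeAt j = trans (sym (insertAt-punchIn (removeAt w x) x (lookup w x) j))
                            (cong (λ w′ → lookup w′ (punchIn x j)) (insertAt-removeAt w x))
  ν≡ : ν ≡ removeAt w x
  ν≡ = begin
    ν                                 ≡⟨ tabulate∘lookup ν ⟨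
    tabulate (lookup ν)               ≡⟨ tabulate-cong (λ j → trans (sym (w∘punchIn≡ν j)) (sym (lookup-removeAt j))) ⟩
    tabulate (lookup (removeAt w x))  ≡⟨ tabulate∘lookup (removeAt w x) ⟩
    removeAt w x                      ∎

T-inDom : (dom : Fin n → List ℤ) (ν : Vec ℤ n) → T (inDom dom ν) ⇔ (∀ i → T (lookup ν i ∈ᵇ dom i))
T-inDom dom ν = mk⇔ (tabulate⁻ ∘ all⁺ _ _) (all⁻ _ ∘ tabulate⁺)

inDom-insertAt : ∀ (dom : Fin (suc n) → List ℤ) ν x z →
  inDom dom (insertAt ν x z) ≡ (z ∈ᵇ dom x) ∧ inDom (dom ∘ punchIn x) ν
inDom-insertAt dom ν x z = T-injective (mk⇔ split join)
  where
  split : T (inDom dom (insertAt ν x z)) → T ((z ∈ᵇ dom x) ∧ inDom (dom ∘ punchIn x) ν)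
  split ν∈ = Equivalence.from T-∧
    ( subst (λ w → T (w ∈ᵇ dom x)) (insertAt-lookup ν x z) (at x)
    , Equivalence.from (T-inDom (dom ∘ punchIn x) ν) λ j →
        subst (λ w → T (w ∈ᵇ dom (punchIn x j))) (insertAt-punchIn ν x z j) (at (punchIn x j)))
    where
    at : ∀ i → T (lookup (insertAt ν x z) i ∈ᵇ dom i)
    at = Equivalence.to (T-inDom dom (insertAt ν x z)) ν∈
  join : T ((z ∈ᵇ dom x) ∧ inDom (dom ∘ punchIn x) ν) → T (inDom dom (insertAt ν x z))
  join z∈∧ν∈ with Equivalence.to T-∧ z∈∧ν∈
  ... | z∈ , ν∈ = Equivalence.from (T-inDom dom (insertAt ν x z))
    (lookup-insertAt-elim (λ i w → T (w ∈ᵇ dom i)) ν x z z∈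
                          (Equivalence.to (T-inDom (dom ∘ punchIn x) ν) ν∈))

MentionsOnly : Fin n → Expr n → Set
MentionsOnly x e = ∀ y → Occurs y e → x ≡ y

AssignsFromItself : Fin n → Update n → Set
AssignsFromItself x u = ∀ e → lookup u x ≡ just e → MentionsOnly x e

lookup-applyU : ∀ (u : Update n) ν i →
  lookup (applyU u ν) i ≡ maybe′ (λ e → eval e ν) (lookup ν i) (lookup u i)
lookup-applyU u ν = lookup∘tabulate (λ i → maybe′ (λ e → eval e ν) (lookup ν i) (lookup u i))

module _ {c ℓ} (R : CommutativeSemiring c ℓ) {n} (x : Fin (suc n)) (z : ℤ) where

  lookup-substU : ∀ u j → lookup (substU R x z u) j ≡ Maybe.map (substE R x z) (lookup u (punchIn x j))
  lookup-substU u = lookup∘tabulate (λ j → Maybe.map (substE R x z) (lookup u (punchIn x j)))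

  eval-substE : ∀ e ν → eval (substE R x z e) ν ≡ eval e (insertAt ν x z)
  eval-substE (lit k)      ν = refl
  eval-substE (var i)      ν with i Fin.≟ x
  ... | yes refl = sym (insertAt-lookup ν x z)
  ... | no i≢x   = sym (trans (cong (lookup (insertAt ν x z)) (sym (punchIn-punchOut (i≢x ∘ sym))))
                              (insertAt-punchIn ν x z _))
  eval-substE (op₁ f e)    ν = cong f (eval-substE e ν)
  eval-substE (op₂ f e e′) ν = cong₂ f (eval-substE e ν) (eval-substE e′ ν)

  holds-substG : ∀ g ν → holds (substG R x z g) ν ≡ holds g (insertAt ν x z)
  holds-substG tt           ν = refl
  holds-substG (rel r e e′) ν = cong₂ r (eval-substE e ν) (eval-substE e′ ν)
  holds-substG (neg g)      ν = cong not (holds-substG g ν)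
  holds-substG (conj g g′)  ν = cong₂ _∧_ (holds-substG g ν) (holds-substG g′ ν)
  holds-substG (disj g g′)  ν = cong₂ _∨_ (holds-substG g ν) (holds-substG g′ ν)

  eval-substE-const : ∀ e → MentionsOnly x e → ∀ ν ν′ →
    eval (substE R x z e) ν ≡ eval (substE R x z e) ν′
  eval-substE-const (lit k)      _      ν ν′ = refl
  eval-substE-const (var i)      x-only ν ν′ with i Fin.≟ x
  ... | yes _  = refl
  ... | no i≢x = ⊥-elim (i≢x (sym (x-only i here)))
  eval-substE-const (op₁ f e)    x-only ν ν′ = cong f (eval-substE-const e (λ y → x-only y ∘ in₁) ν ν′)
  eval-substE-const (op₂ f e e′) x-only ν ν′ =
    cong₂ f (eval-substE-const e  (λ y → x-only y ∘ in₂ˡ) ν ν′)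
            (eval-substE-const e′ (λ y → x-only y ∘ in₂ʳ) ν ν′)

  applyU-substU : ∀ u → AssignsFromItself x u → ∀ ν →
    insertAt (applyU (substU R x z u) ν) x (newX R x z u) ≡ applyU u (insertAt ν x z)
  applyU-substU u x-self ν = insertAt-unique (applyU (substU R x z u) ν) x (newX R x z u) (applyU u ν⁺)
    (trans (lookup-applyU u ν⁺ x) (value-of-x (lookup u x) refl)) values-of-others
    where
    ν⁺ : Vec ℤ (suc n)
    ν⁺ = insertAt ν x z

    evalAt : ∀ {m} → Vec ℤ m → Expr m → ℤ
    evalAt ν e = eval e ν

    -- newX evaluates at the all-zero valuation; this is harmless as the assignment reads only x.
    value-of-x : ∀ m → lookup u x ≡ m →
      maybe′ (evalAt ν⁺) (lookup ν⁺ x) m ≡ maybe′ (evalAt (replicate n (ℤ.+ 0)) ∘ substE R x z) z m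
    value-of-x nothing  _   = insertAt-lookup ν x z
    value-of-x (just e) u≡e = begin
      eval e ν⁺                                    ≡⟨ eval-substE e ν ⟨
      eval (substE R x z e) ν                      ≡⟨ eval-substE-const e (x-self e u≡e) ν _ ⟩
      eval (substE R x z e) (replicate n (ℤ.+ 0))  ∎
      where open ≡-Reasoning

    maybe-map-substE : ∀ {d : ℤ} m →
      maybe′ (evalAt ν) d (Maybe.map (substE R x z) m) ≡ maybe′ (evalAt ν⁺) d m
    maybe-map-substE nothing  = refl
    maybe-map-substE (just e) = eval-substE e ν

    values-of-others : ∀ j → lookup (applyU u ν⁺) (punchIn x j) ≡ lookup (applyU (substU R x z u) ν) j
    values-of-others j = begin
      lookup (applyU u ν⁺) (punchIn x j)
        ≡⟨ lookup-applyU u ν⁺ (punchIn x j) ⟩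
      maybe′ (evalAt ν⁺) (lookup ν⁺ (punchIn x j)) (lookup u (punchIn x j))
        ≡⟨ cong (λ d → maybe′ (evalAt ν⁺) d (lookup u (punchIn x j))) (insertAt-punchIn ν x z j) ⟩
      maybe′ (evalAt ν⁺) (lookup ν j) (lookup u (punchIn x j))
        ≡⟨ maybe-map-substE (lookup u (punchIn x j)) ⟨
      maybe′ (evalAt ν) (lookup ν j) (Maybe.map (substE R x z) (lookup u (punchIn x j)))
        ≡⟨ cong (maybe′ (evalAt ν) (lookup ν j)) (lookup-substU u j) ⟨
      maybe′ (evalAt ν) (lookup ν j) (lookup (substU R x z u) j)
        ≡⟨ lookup-applyU (substU R x z u) ν j ⟨
      lookup (applyU (substU R x z u) ν) j ∎
      where open ≡-Reasoning

module Unfolding {c ℓ} (R : CommutativeSemiring c ℓ) {n} (P : PCFP R (suc n)) (x : Fin (suc n))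
                 (wf : WF R P) (unf : Unfoldable R P x) where
  open PCFP P
  open CommutativeSemiring R using (_≈_; 0#) renaming (Carrier to Prob; reflexive to ≈-reflexive)
  open Grid (unfCmd R P x) (dom x)

  U : PCFP R n
  U = Unf R P x

  _≟LU_ : DecidableEquality (Loc × ℤ)
  _≟LU_ = PCFP._≟L_ U

  ren : RawState R U → RawState R P
  ren = rename R P x

  unren : RawState R P → RawState R U
  unren nothing        = nothing
  unren (just (l , ν)) = just ((l , lookup ν x) , removeAt ν x)

  ren-unren : ∀ s → ren (unren s) ≡ s
  ren-unren nothing        = refl
  ren-unren (just (l , ν)) = cong (λ ν → just (l , ν)) (insertAt-removeAt ν x)

  unren-ren : ∀ s → unren (ren s) ≡ s
  unren-ren nothing              = refl
  unren-ren (just ((l , z) , ν)) =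
    cong₂ (λ z ν → just ((l , z) , ν)) (insertAt-lookup ν x z) (removeAt-insertAt ν x z)

  ren-injective : Injective _≡_ _≡_ ren
  ren-injective {s} {s′} eq = trans (sym (unren-ren s)) (trans (cong unren eq) (unren-ren s′))

  okRaw-ren : ∀ s → okRaw R P (ren s) ≡ okRaw R U s
  okRaw-ren nothing              = refl
  okRaw-ren (just ((l , z) , ν)) =
    trans (cong (isLoc l ∧_) (inDom-insertAt dom ν x z)) (sym (∧-assoc (isLoc l) _ _))

  states↔ : Σ (RawState R U) (T ∘ okRaw R U) ↔ Σ (RawState R P) (T ∘ okRaw R P)
  states↔ = Σ-irrelevant-↔ T-irrelevant T-irrelevant ren unren
    (λ {s} → subst T (sym (okRaw-ren s)))
    (λ {s} → subst T (trans (cong (okRaw R P) (sym (ren-unren s))) (okRaw-ren (unren s))))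
    (λ {s} _ → ren-unren s) (λ {s} _ → unren-ren s)

  Enabled : ∀ {L : Set} {m} → DecidableEquality L → L × Vec ℤ m → Command R L m → Bool
  Enabled _≟_ (l , ν) γ = does (l ≟ Command.src γ) ∧ holds (Command.guard γ) ν

  Enabled-unfCmd : ∀ l z ν γ z′ →
    T (Enabled _≟LU_ ((l , z) , ν) (unfCmd R P x γ z′)) ⇔ (z′ ≡ z × T (Enabled _≟L_ (l , insertAt ν x z) γ))
  Enabled-unfCmd l z ν γ z′ = mk⇔ to from
    where
    src : Loc
    src = Command.src γ
    guard : Guard (suc n)
    guard = Command.guard γ

    to : T (Enabled _≟LU_ ((l , z) , ν) (unfCmd R P x γ z′)) →
         z′ ≡ z × T (Enabled _≟L_ (l , insertAt ν x z) γ)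
    to e with Equivalence.to T-∧ e
    ... | at-src , holds-guard with ,-injective (Equivalence.to (T-does ((l , z) ≟LU (src , z′))) at-src)
    ... | l≡src , refl = refl , Equivalence.from T-∧
      (Equivalence.from (T-does (l ≟L src)) l≡src , subst T (holds-substG R x z guard ν) holds-guard)

    from : z′ ≡ z × T (Enabled _≟L_ (l , insertAt ν x z) γ) →
           T (Enabled _≟LU_ ((l , z) , ν) (unfCmd R P x γ z′))
    from (refl , e) with Equivalence.to T-∧ e
    ... | at-src , holds-guard = Equivalence.from T-∧
      ( Equivalence.from (T-does ((l , z) ≟LU (src , z))) (cong (_, z) (Equivalence.to (T-does (l ≟L src)) at-src))
      , subst T (sym (holds-substG R x z guard ν)) holds-guard)

  enabled-pair : ∀ l z ν i j →
    T (enabled R U (just ((l , z) , ν)) (pair cmds i j))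
      ⇔ (List.lookup (dom x) j ≡ z × T (enabled R P (just (l , insertAt ν x z)) i))
  enabled-pair l z ν i j =
    subst (λ γ → T (Enabled _≟LU_ ((l , z) , ν) γ)
                   ⇔ (List.lookup (dom x) j ≡ z × T (enabled R P (just (l , insertAt ν x z)) i)))
          (sym (lookup-pair cmds i j))
          (Enabled-unfCmd l z ν (cmdAt R P i) (List.lookup (dom x) j))

  enabled-unpair : ∀ l z ν k → T (enabled R U (just ((l , z) , ν)) k) →
    List.lookup (dom x) (proj₂ (unpair cmds k)) ≡ z
      × T (enabled R P (just (l , insertAt ν x z)) (proj₁ (unpair cmds k)))
  enabled-unpair l z ν k e = Equivalence.to (enabled-pair l z ν _ _)
    (subst (T ∘ enabled R U (just ((l , z) , ν))) (sym (pair-unpair cmds k)) e)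

  okRaw⇒∈dom : ∀ l z ν → T (okRaw R U (just ((l , z) , ν))) → T (z ∈ᵇ dom x)
  okRaw⇒∈dom l z ν = proj₂ ∘ Equivalence.to (T-∧ {isLoc l}) ∘ proj₁ ∘ Equivalence.to (T-∧ {isLoc l ∧ (z ∈ᵇ dom x)})

  -- Only the copy of a command for the value z stored in the location can be enabled, and that
  -- copy is unique because dom x is duplicate-free.
  actions↔ : ∀ (s : Σ (RawState R U) (T ∘ okRaw R U)) →
    Σ (Fin (length (grid cmds))) (T ∘ enabled R U (proj₁ s))
      ↔ Σ (Fin (length cmds)) (T ∘ enabled R P (proj₁ (Inverse.to states↔ s)))
  actions↔ (nothing , _) = mk↔ₛ′ (λ ()) (λ ()) (λ ()) (λ ())
  actions↔ (just ((l , z) , ν) , ok) with ∈ᵇ⇒lookup (dom x) (okRaw⇒∈dom l z ν ok)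
  ... | jz , dom[jz]≡z = Σ-irrelevant-↔ T-irrelevant T-irrelevant
    (proj₁ ∘ unpair cmds) (λ i → pair cmds i jz)
    (λ {k} → proj₂ ∘ enabled-unpair l z ν k)
    (λ e → Equivalence.from (enabled-pair l z ν _ jz) (dom[jz]≡z , e))
    (λ {i} _ → cong proj₁ (unpair-pair cmds i jz))
    (λ {k} e → trans (cong (pair cmds _) (jz≡ k e)) (pair-unpair cmds k))
    where
    jz≡ : ∀ k → T (enabled R U (just ((l , z) , ν)) k) → jz ≡ proj₂ (unpair cmds k)
    jz≡ k e = lookup-injective (proj₁ wf x) jz _ (trans dom[jz]≡z (sym (proj₁ (enabled-unpair l z ν k e))))

  weight : ∀ {m} (Q : PCFP R m) → Vec ℤ m → RawState R Q → Branch R (PCFP.Loc Q) m → Prob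
  weight Q ν t b = if does (_≟R_ R Q (target R Q ν b) t) then Branch.prob b else 0#

  target-unfBranch : ∀ z ν b → AssignsFromItself x (Branch.upd b) →
    ren (target R U ν (unfBranch R P x z b)) ≡ target R P (insertAt ν x z) b
  target-unfBranch z ν (branch _ u l) x-self = begin
    ren (if (isLoc l ∧ (z′ ∈ᵇ dom x)) ∧ inDom (dom ∘ punchIn x) ν′ then just ((l , z′) , ν′) else nothing)
      ≡⟨ if-float ren ((isLoc l ∧ (z′ ∈ᵇ dom x)) ∧ inDom (dom ∘ punchIn x) ν′) ⟩
    (if (isLoc l ∧ (z′ ∈ᵇ dom x)) ∧ inDom (dom ∘ punchIn x) ν′ then just (l , insertAt ν′ x z′) else nothing)
      ≡⟨ cong (if_then just (l , insertAt ν′ x z′) else nothing) (okRaw-ren (just ((l , z′) , ν′))) ⟨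
    (if isLoc l ∧ inDom dom (insertAt ν′ x z′) then just (l , insertAt ν′ x z′) else nothing)
      ≡⟨ cong (λ ν⁺ → if isLoc l ∧ inDom dom ν⁺ then just (l , ν⁺) else nothing)
              (applyU-substU R x z u x-self ν) ⟩
    (if isLoc l ∧ inDom dom ν⁺ then just (l , ν⁺) else nothing) ∎
    where
    open ≡-Reasoning
    z′ : ℤ
    z′ = newX R x z u
    ν′ : Vec ℤ n
    ν′ = applyU (substU R x z u) ν
    ν⁺ : Vec ℤ (suc n)
    ν⁺ = applyU u (insertAt ν x z)

  weight-unfBranch : ∀ z ν t b → AssignsFromItself x (Branch.upd b) →
    weight U ν t (unfBranch R P x z b) ≡ weight P (insertAt ν x z) (ren t) b
  weight-unfBranch z ν t b x-self = cong (if_then Branch.prob b else 0#) (begin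
    does (_≟R_ R U s t)
      ≡⟨ injective⇒does-≡ ren ren-injective (_≟R_ R U) (_≟R_ R P) s t ⟩
    does (_≟R_ R P (ren s) (ren t))
      ≡⟨ cong (λ s → does (_≟R_ R P s (ren t))) (target-unfBranch z ν b x-self) ⟩
    does (_≟R_ R P (target R P (insertAt ν x z) b) (ren t)) ∎)
    where
    open ≡-Reasoning
    s : RawState R U
    s = target R U ν (unfBranch R P x z b)

  branch-assignsFromItself : ∀ {γ} → γ ∈ cmds → ∀ {b} → b ∈ Command.branches γ →
                             AssignsFromItself x (Branch.upd b)
  branch-assignsFromItself γ∈ b∈ e u≡e y occ = unf y (_ , γ∈ , _ , b∈ , e , u≡e , occ)

  probRaw-unfold : ∀ l z ν k t → T (enabled R U (just ((l , z) , ν)) k) →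
    probRaw R U (just ((l , z) , ν)) k t ≡ probRaw R P (just (l , insertAt ν x z)) (proj₁ (unpair cmds k)) (ren t)
  probRaw-unfold l z ν k t e = begin
    sumP R (map (weight U ν t) (Command.branches (cmdAt R U k)))
      ≡⟨ cong (λ γ′ → sumP R (map (weight U ν t) (Command.branches γ′))) cmdAt-k ⟩
    sumP R (map (weight U ν t) (map (unfBranch R P x z) (Command.branches γ)))
      ≡⟨ cong (sumP R) (map-∘ (Command.branches γ)) ⟨
    sumP R (map (weight U ν t ∘ unfBranch R P x z) (Command.branches γ))
      ≡⟨ cong (sumP R) (map-cong-local (All.tabulate λ {b} b∈ →
           weight-unfBranch z ν t b (branch-assignsFromItself (∈-lookup i) b∈))) ⟩
    sumP R (map (weight P (insertAt ν x z) (ren t)) (Command.branches γ)) ∎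
    where
    open ≡-Reasoning
    i : Fin (length cmds)
    i = proj₁ (unpair cmds k)
    j : Fin (length (dom x))
    j = proj₂ (unpair cmds k)
    γ : Command R Loc (suc n)
    γ = cmdAt R P i
    cmdAt-k : cmdAt R U k ≡ unfCmd R P x γ z
    cmdAt-k = begin
      cmdAt R U k                             ≡⟨ cong (cmdAt R U) (pair-unpair cmds k) ⟨
      cmdAt R U (pair cmds i j)               ≡⟨ lookup-pair cmds i j ⟩
      unfCmd R P x γ (List.lookup (dom x) j)  ≡⟨ cong (unfCmd R P x γ) (proj₁ (enabled-unpair l z ν k e)) ⟩
      unfCmd R P x γ z                        ∎

  transitions : ∀ s a t →
    probRaw R U (proj₁ s) (proj₁ a) (proj₁ t)
      ≈ probRaw R P (proj₁ (Inverse.to states↔ s)) (proj₁ (Inverse.to (actions↔ s) a))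
                    (proj₁ (Inverse.to states↔ t))
  transitions (nothing , _)             (_ , ())  _
  transitions (just ((l , z) , ν) , _) (k , e) (t , _) = ≈-reflexive (probRaw-unfold l z ν k t e)

  initOK-Unf : initOK R P → initOK R U
  initOK-Unf ok = proj₂ (Inverse.from states↔ (just (ι-loc , ι-val) , ok))

  Unf-iso : (ok : initOK R P) → MDPIso R (⟦_⟧ R U (initOK-Unf ok)) (⟦_⟧ R P ok)
  Unf-iso ok = record
    { st   = states↔
    ; init = Inverse.strictlyInverseˡ states↔ (just (ι-loc , ι-val) , ok)
    ; act  = actions↔
    ; pr   = transitions
    }

lemma1 : ∀ {c ℓ : Level} (R : CommutativeSemiring c ℓ) {n : ℕ}
           (P : PCFP R (suc n)) (x : Fin (suc n)) →
           WF R P → Unfoldable R P x →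
           (ok : initOK R P) →
           Σ (initOK R (Unf R P x)) λ ok′ →
           Σ (MDPIso R (⟦_⟧ R (Unf R P x) ok′) (⟦_⟧ R P ok)) λ iso →
             ∀ s → proj₁ (Inverse.to (MDPIso.st iso) s) ≡ rename R P x (proj₁ s)
lemma1 R P x wf unf ok = initOK-Unf ok , Unf-iso ok , λ _ → refl
  where open Unfolding R P x wf unf
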